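{- Let $V$ be any set (finite or infinite) with $|V|\ge 3$, and let $R$ be the monotone graph property "the graph contains a cycle". Then $R$ is strongly elusive on $V$, i.e. Bob has a winning strategy in the game $\mathbb E_{V,R}$.
   Context: For a graph $H=\langle V,E^*\rangle$, an $H$-pregraph is a triple $G=\langle V,E,N\rangle$ with $E\cup N\subseteq E^*$ and $E\cap N=\emptyset$ ($E$ = edges, $N$ = nonedges, $P=E\cup N$ = determined pairs, $U=E^*\setminus P$ = undetermined pairs). An $H$-graph is a graph $\langle V,E\rangle$ with $E\subseteq E^*$; it extends the pregraph $\langle V,E_0,N_0\rangle$ if $E_0\subseteq E$ and $N_0\cap E=\emptyset$. The game $\mathbb E_{H,R}$ between Alice and Bob: they build a transfinite sequence $\langle G_\alpha:\alpha\le\beta\rangle$ of $H$-pregraphs with $G_0=\langle V,\emptyset,\emptyset\rangle$; at limit $\alpha$, the edge set and nonedge set of $G_\alpha$ are the unions of the earlier ones; at a successor step $\gamma+1$ (if the game has not terminated) Alice picks an undetermined pair $e_\gamma$ of $G_\gamma$ and Bob declares it an edge or a nonedge, giving $G_{\gamma+1}$. The game terminates at the first $\beta$ such that either every $H$-graph extending $G_\beta$ has property $R$ or no $H$-graph extending $G_\beta$ has property $R$. Bob wins iff at termination every pair of $E^*$ is determined. $\mathbb E_{V,R}$ denotes $\mathbb E_{H,R}$ with $H$ the complete graph on $V$ (i.e. $E^*=[V]^2$). $R$ is strongly elusive on $V$ iff Bob has a winning strategy in $\mathbb E_{V,R}$. -}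

module Defs where

open import Level using (0ℓ) renaming (suc to lsuc)
open import Data.Nat using (ℕ; suc)
open import Data.Fin using (Fin; zero; suc; inject₁; fromℕ)
open import Data.Bool using (Bool; true; false)
open import Data.Product using (Σ; Σ-syntax; _×_; _,_; proj₁; proj₂)
open import Data.Sum using (_⊎_)
open import Data.Empty using (⊥)
open import Data.Unit using (⊤)
open import Relation.Nullary using (¬_)
open import Relation.Binary.PropositionalEquality using (_≡_; _≢_)
open import Relation.Binary using (Rel; IsStrictTotalOrder)
open import Induction.WellFounded using (WellFounded)
open import Function.Definitions using (Injective)

module _ {V : Set} where

  -- Graphs on V (subgraphs of the complete graph on V): a set of
  -- unordered pairs {x,y} (x ≠ y) encoded as a symmetric irreflexive
  -- adjacency predicate.
  record Graph : Set₁ where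
    field
      Adj    : V → V → Set
      sym    : ∀ {x y} → Adj x y → Adj y x
      irrefl : ∀ {x} → ¬ Adj x x
  open Graph public

  HasCycle : Graph → Set
  HasCycle G =
    Σ[ k ∈ ℕ ] Σ[ f ∈ (Fin (suc (suc (suc k))) → V) ]
      Injective _≡_ _≡_ f
      × (∀ (i : Fin (suc (suc k))) → Adj G (f (inject₁ i)) (f (suc i)))
      × Adj G (f (fromℕ (suc (suc k)))) (f zero)

  -- Pregraphs: E = edges, N = nonedges (as predicates on ordered
  -- pairs; the play below only ever produces symmetric ones).
  record Pregraph : Set₁ where
    field
      E : V → V → Set
      N : V → V → Set
  open Pregraph public

  Extends : Graph → Pregraph → Set
  Extends H G = (∀ {x y} → E G x y → Adj H x y) × (∀ {x y} → N G x y → ¬ Adj H x y)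

  Determined : Pregraph → V → V → Set
  Determined G x y = E G x y ⊎ N G x y

  Undetermined : Pregraph → V → V → Set
  Undetermined G x y = ¬ E G x y × ¬ N G x y

  AllDetermined : Pregraph → Set
  AllDetermined G = ∀ x y → x ≢ y → Determined G x y

  Terminal : (Graph → Set) → Pregraph → Set₁
  Terminal R G = (∀ H → Extends H G → R H) ⊎ (∀ H → Extends H G → ¬ R H)

  -- Moves: Alice's pair and Bob's answer (true = edge, false = nonedge).
  SamePair : V × V → V → V → Set
  SamePair (a , b) x y = (a ≡ x × b ≡ y) ⊎ (a ≡ y × b ≡ x)

  pregraphOf : {I : Set} → (I → V × V) → (I → Bool) → (I → Set) → Pregraph
  pregraphOf {I} pr an S = record
    { E = λ x y → Σ[ γ ∈ I ] S γ × an γ ≡ true  × SamePair (pr γ) x y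
    ; N = λ x y → Σ[ γ ∈ I ] S γ × an γ ≡ false × SamePair (pr γ) x y }

  -- What Bob's strategy sees: the history so far (an ordered family of
  -- moves) together with Alice's current pair.
  record Past : Set₁ where
    field
      J     : Set
      _≺_   : Rel J 0ℓ
      pastPair : J → V × V
      pastAns  : J → Bool

  Strategy : Set₁
  Strategy = Past → V → V → Bool

  -- A (possibly transfinite) play: moves indexed by a well-order I.
  record Play : Set₁ where
    field
      I       : Set
      _<_     : Rel I 0ℓ
      isSTO   : IsStrictTotalOrder _≡_ _<_
      wf      : WellFounded _<_
      pair    : I → V × V
      ans     : I → Bool
  open Play public

  before : (p : Play) → I p → Pregraph
  before p α = pregraphOf (pair p) (ans p) (λ γ → _<_ p γ α)

  final : Play → Pregraph
  final p = pregraphOf (pair p) (ans p) (λ _ → ⊤)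

  pastAt : (p : Play) → I p → Past
  pastAt p α = record
    { J = Σ[ γ ∈ I p ] _<_ p γ α
    ; _≺_ = λ a b → _<_ p (proj₁ a) (proj₁ b)
    ; pastPair = λ a → pair p (proj₁ a)
    ; pastAns  = λ a → ans p (proj₁ a) }

  Legal : (Graph → Set) → Play → Set₁
  Legal R p = ∀ α →
      ¬ Terminal R (before p α)
    × proj₁ (pair p α) ≢ proj₂ (pair p α)
    × Undetermined (before p α) (proj₁ (pair p α)) (proj₂ (pair p α))

  Follows : Strategy → Play → Set
  Follows σ p = ∀ α → ans p α ≡ σ (pastAt p α) (proj₁ (pair p α)) (proj₂ (pair p α))

  Winning : (Graph → Set) → Strategy → Set₁
  Winning R σ = ∀ (p : Play) → Legal R p → Follows σ p →
    Terminal R (final p) → AllDetermined (final p)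

  StronglyElusive : (Graph → Set) → Set₁
  StronglyElusive R = Σ[ σ ∈ Strategy ] Winning R σ

AtLeast3 : Set → Set
AtLeast3 V = Σ[ a ∈ V ] Σ[ b ∈ V ] Σ[ c ∈ V ] a ≢ b × a ≢ c × b ≢ c

-- Bob answers "edge" exactly when the two vertices are not yet joined by a path of edges.
-- Then every edge joins two components of the earlier edges, so along the well-ordered play
-- the edges never close a cycle: the graph of edges is an acyclic extension of the final
-- position. Every nonedge, on the other hand, joins two vertices already connected by edges.
-- So if some pair {u , v} were left undetermined, the graph of all pairs that are not
-- nonedges would contain the edge forest, every pair across two of its components, and uv;
-- with a third vertex w this graph has a cycle through uv. Hence the final position has
-- both a cyclic and an acyclic extension, and the game has not terminated.
module Submission where

open import Level using (0ℓ) renaming (suc to lsuc)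
open import Axiom.ExcludedMiddle using (ExcludedMiddle)
open import Data.Bool using (true; false)
open import Data.Empty using (⊥-elim)
open import Data.Fin using (Fin; zero; suc; inject₁; fromℕ)
open import Data.Fin.Properties using (suc-injective)
open import Data.List using (List; []; _∷_; _++_; length; tabulate)
open import Data.List.Membership.Propositional using (_∈_; _∉_)
open import Data.List.Membership.Propositional.Properties using (∈-++⁺ˡ; ∈-++⁺ʳ; ∈-tabulate⁻)
open import Data.List.Relation.Unary.Any using (here; there)
open import Data.Nat using (ℕ; zero; suc)
open import Data.Product using (Σ-syntax; ∃; _×_; _,_; proj₁; proj₂; uncurry)
open import Data.Sum using (_⊎_; inj₁; inj₂; swap)
open import Function using (_∘_)
open import Function.Definitions using (Injective)
open import Induction.WellFounded using (Acc; acc)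
open import Relation.Binary using (Rel; Symmetric; _⇒_; IsStrictTotalOrder; tri<; tri≈; tri>)
open import Relation.Binary.Construct.Closure.ReflexiveTransitive
  using (Star; ε; _◅_; _◅◅_; reverse) renaming (map to mapStar)
open import Relation.Binary.Construct.Union using (_∪_)
open import Relation.Binary.PropositionalEquality using (_≡_; _≢_; refl; sym; trans; cong; subst)
open import Relation.Nullary using (¬_; yes; no)
open import Defs hiding (sym)

module _ {V : Set} where

  private variable
    R R′ : Rel V 0ℓ
    a b c d u v w x y z : V
    ps qs vs : List V

  -- vs lists the vertices after x, so the path visits x ∷ vs.
  data SimplePath (R : Rel V 0ℓ) : V → V → List V → Set where
    stop : SimplePath R x x []
    step : R x y → SimplePath R y z vs → x ∉ y ∷ vs → SimplePath R x z (y ∷ vs)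

  data Cycle (R : Rel V 0ℓ) : Set where
    cycle : ∀ {y₁ y₂} → SimplePath R x z (y₁ ∷ y₂ ∷ vs) → R z x → Cycle R

  last∈ : SimplePath R x z vs → z ∈ x ∷ vs
  last∈ stop = here refl
  last∈ (step _ p _) = there (last∈ p)

  toStar : SimplePath R x z vs → Star R x z
  toStar stop = ε
  toStar (step r p _) = r ◅ toStar p

  mapPath : R ⇒ R′ → SimplePath R x z vs → SimplePath R′ x z vs
  mapPath f stop = stop
  mapPath f (step r p x∉) = step (f r) (mapPath f p) x∉

  mapCycle : R ⇒ R′ → Cycle R → Cycle R′
  mapCycle f (cycle p r) = cycle (mapPath f p) (f r)

  dropTo : y ∈ x ∷ vs → SimplePath R x z vs → ∃ (SimplePath R y z)
  dropTo (here refl) p = _ , p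
  dropTo (there y∈) (step _ p _) = dropTo y∈ p

  loopErase : ExcludedMiddle 0ℓ → Star R x z → ∃ (SimplePath R x z)
  loopErase em ε = [] , stop
  loopErase {x = x} em (_◅_ {j = y} r s) with loopErase em s
  ... | vs , p with em {x ∈ y ∷ vs}
  ...   | yes x∈ = dropTo x∈ p
  ...   | no x∉ = y ∷ vs , step r p x∉

  Chain : Rel V 0ℓ → (n : ℕ) → (Fin (suc n) → V) → Set
  Chain R n f = ∀ (i : Fin n) → R (f (inject₁ i)) (f (suc i))

  fromChain : ∀ n (f : Fin (suc n) → V) → Injective _≡_ _≡_ f → Chain R n f →
              SimplePath R (f zero) (f (fromℕ n)) (tabulate (f ∘ suc))
  fromChain zero f _ _ = stop
  fromChain (suc n) f f-inj chain =
    step (chain zero) (fromChain n (f ∘ suc) (suc-injective ∘ f-inj) (chain ∘ suc)) f₀∉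
    where
      f₀∉ : f zero ∉ tabulate (f ∘ suc)
      f₀∉ f₀∈ with ∈-tabulate⁻ f₀∈
      ... | i , eq with f-inj {zero} {suc i} eq
      ... | ()

  vertex : SimplePath R x z vs → Fin (suc (length vs)) → V
  vertex {x = x} _ zero = x
  vertex (step _ p _) (suc i) = vertex p i

  vertex-last : (p : SimplePath R x z vs) → vertex p (fromℕ (length vs)) ≡ z
  vertex-last stop = refl
  vertex-last (step _ p _) = vertex-last p

  vertex-∈ : (p : SimplePath R x z vs) (i : Fin (suc (length vs))) → vertex p i ∈ x ∷ vs
  vertex-∈ _ zero = here refl
  vertex-∈ (step _ p _) (suc i) = there (vertex-∈ p i)

  vertex-injective : (p : SimplePath R x z vs) → Injective _≡_ _≡_ (vertex p)
  vertex-injective _ {zero} {zero} _ = refl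
  vertex-injective (step _ p x∉) {zero} {suc j} eq = ⊥-elim (x∉ (subst (_∈ _) (sym eq) (vertex-∈ p j)))
  vertex-injective (step _ p x∉) {suc i} {zero} eq = ⊥-elim (x∉ (subst (_∈ _) eq (vertex-∈ p i)))
  vertex-injective (step _ p _) {suc i} {suc j} eq = cong suc (vertex-injective p eq)

  vertex-chain : (p : SimplePath R x z vs) → Chain R (length vs) (vertex p)
  vertex-chain (step r _ _) zero = r
  vertex-chain (step _ p _) (suc i) = vertex-chain p i

  hasCycle⇒cycle : (H : Graph) → HasCycle H → Cycle (Adj H)
  hasCycle⇒cycle H (k , f , f-inj , chain , closing) =
    cycle (fromChain (suc (suc k)) f f-inj chain) closing

  cycle⇒hasCycle : (H : Graph) → Cycle (Adj H) → HasCycle H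
  cycle⇒hasCycle H (cycle {vs = vs} p r) =
    length vs , vertex p , vertex-injective p , vertex-chain p ,
    subst (λ z → Adj H z _) (sym (vertex-last p)) r

  samePair-sym : SamePair (a , b) c d → SamePair (c , d) a b
  samePair-sym (inj₁ (refl , refl)) = inj₁ (refl , refl)
  samePair-sym (inj₂ (refl , refl)) = inj₂ (refl , refl)

  samePair-trans : SamePair (a , b) c d → SamePair (c , d) x y → SamePair (a , b) x y
  samePair-trans (inj₁ (refl , refl)) cd = cd
  samePair-trans (inj₂ (refl , refl)) (inj₁ (refl , refl)) = inj₂ (refl , refl)
  samePair-trans (inj₂ (refl , refl)) (inj₂ (refl , refl)) = inj₁ (refl , refl)

  orient : Symmetric R → SamePair (a , b) x y → Star R x y → Star R a b
  orient _ (inj₁ (refl , refl)) s = s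
  orient R-sym (inj₂ (refl , refl)) s = reverse R-sym s

  -- A simple path from x to z that traverses the edge {a , b} once, from c to d.
  data Crossing (R : Rel V 0ℓ) (a b : V) : V → V → List V → Set where
    crossing : ∀ ps qs → SamePair (a , b) c d → vs ≡ ps ++ d ∷ qs →
               SimplePath R x c ps → SimplePath R d z qs → Crossing R a b x z vs

  crossing-step : R x y → x ∉ y ∷ vs → Crossing R a b y z vs → Crossing R a b x z (y ∷ vs)
  crossing-step r x∉ (crossing ps qs cd refl pc pd) =
    crossing (_ ∷ ps) qs cd refl (step r pc (x∉ ∘ ∈-++⁺ˡ)) pd

  crossing-ends : Crossing R a b x z vs → a ∈ x ∷ vs × b ∈ x ∷ vs
  crossing-ends (crossing ps _ (inj₁ (refl , refl)) refl pc _) =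
    ∈-++⁺ˡ (last∈ pc) , ∈-++⁺ʳ (_ ∷ ps) (here refl)
  crossing-ends (crossing ps _ (inj₂ (refl , refl)) refl pc _) =
    ∈-++⁺ʳ (_ ∷ ps) (here refl) , ∈-++⁺ˡ (last∈ pc)

  endpoint∈ : SamePair (a , b) x y → a ∈ vs → b ∈ vs → x ∈ vs
  endpoint∈ (inj₁ (refl , _)) a∈ _ = a∈
  endpoint∈ (inj₂ (_ , refl)) _ b∈ = b∈

  splitAtEdge : SimplePath (R ∪ SamePair (a , b)) x z vs → SimplePath R x z vs ⊎ Crossing R a b x z vs
  splitAtEdge stop = inj₁ stop
  splitAtEdge (step r p x∉) with r | splitAtEdge p
  ... | inj₁ r′ | inj₁ p′ = inj₁ (step r′ p′ x∉)
  ... | inj₁ r′ | inj₂ cr = inj₂ (crossing-step r′ x∉ cr)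
  ... | inj₂ e | inj₁ p′ = inj₂ (crossing [] _ e refl stop p′)
  ... | inj₂ e | inj₂ cr = ⊥-elim (x∉ (uncurry (endpoint∈ e) (crossing-ends cr)))

  shortLoop : ∀ {y₁ y₂} → SimplePath R x x ps → SimplePath R z z qs → y₁ ∷ y₂ ∷ vs ≢ ps ++ d ∷ qs
  shortLoop stop stop ()
  shortLoop (step _ p x∉) _ _ = x∉ (last∈ p)
  shortLoop stop (step _ p z∉) _ = z∉ (last∈ p)

  -- The closing edge and the crossing are both {a , b}: either the crossing runs from x to z,
  -- making the path too short, or it runs from z to x and the path before it joins a and b.
  closedCrossing : ∀ {y₁ y₂} → Symmetric R → SamePair (a , b) z x → SamePair (a , b) c d →
                   y₁ ∷ y₂ ∷ vs ≡ ps ++ d ∷ qs → SimplePath R x c ps → SimplePath R d z qs → Star R a b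
  closedCrossing R-sym (inj₁ (refl , refl)) (inj₁ (refl , refl)) _ pc _ = reverse R-sym (toStar pc)
  closedCrossing _ (inj₁ (refl , refl)) (inj₂ (refl , refl)) eq pc pd = ⊥-elim (shortLoop pc pd eq)
  closedCrossing _ (inj₂ (refl , refl)) (inj₁ (refl , refl)) eq pc pd = ⊥-elim (shortLoop pc pd eq)
  closedCrossing _ (inj₂ (refl , refl)) (inj₂ (refl , refl)) _ pc _ = toStar pc

  cycle-∪-edge : Symmetric R → Cycle (R ∪ SamePair (a , b)) → Cycle R ⊎ Star R a b
  cycle-∪-edge R-sym (cycle p r) with splitAtEdge p | r
  ... | inj₁ p′ | inj₁ r′ = inj₁ (cycle p′ r′)
  ... | inj₁ p′ | inj₂ e = inj₂ (orient R-sym e (reverse R-sym (toStar p′)))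
  ... | inj₂ (crossing _ _ cd _ pc pd) | inj₁ r′ =
        inj₂ (orient R-sym (swap cd) (toStar pd ◅◅ r′ ◅ toStar pc))
  ... | inj₂ (crossing _ _ cd eq pc pd) | inj₂ e = inj₂ (closedCrossing R-sym e cd eq pc pd)

  smallestExtension : (G : Pregraph {V}) → Symmetric (E G) → (∀ {x} → ¬ E G x x) → Graph {V}
  smallestExtension G E-sym E-irrefl = record { Adj = E G ; sym = E-sym ; irrefl = E-irrefl }

  largestExtension : (G : Pregraph {V}) → Symmetric (N G) → Graph {V}
  largestExtension G N-sym = record
    { Adj = λ x y → x ≢ y × ¬ N G x y
    ; sym = λ (x≢y , ¬n) → x≢y ∘ sym , ¬n ∘ N-sym
    ; irrefl = λ (x≢x , _) → x≢x refl
    }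

  module _ (G : Pregraph {V}) (E∩N=∅ : ∀ {x y} → E G x y → ¬ N G x y) where

    smallestExtension-extends : (E-sym : Symmetric (E G)) (E-irrefl : ∀ {x} → ¬ E G x x) →
                                Extends (smallestExtension G E-sym E-irrefl) G
    smallestExtension-extends _ _ = (λ e → e) , (λ n e → E∩N=∅ e n)

    largestExtension-extends : (∀ {x} → ¬ E G x x) → (N-sym : Symmetric (N G)) →
                               Extends (largestExtension G N-sym) G
    largestExtension-extends E-irrefl _ =
      (λ e → (λ { refl → E-irrefl e }) , E∩N=∅ e) , (λ n (_ , ¬n) → ¬n n)

  module _ (em : ExcludedMiddle 0ℓ) (F H : Graph {V}) (F⊆H : Adj F ⇒ Adj H)
           (disconnected⇒H : ∀ {x y} → ¬ Star (Adj F) x y → Adj H x y) where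

    private
      _⇝_ : V → V → Set
      x ⇝ y = Star (Adj F) x y

      backwards : x ⇝ y → y ⇝ x
      backwards = reverse (Graph.sym F)

    cycleAcrossComponents : ¬ u ⇝ v → u ⇝ w → w ≢ u → Adj H u v → Cycle (Adj H)
    cycleAcrossComponents {u} {v} {w} u⇝̸v u⇝w w≢u huv with loopErase em (backwards u⇝w)
    ... | [] , stop = ⊥-elim (w≢u refl)
    ... | vs@(_ ∷ _) , p = cycle (step (disconnected⇒H v⇝̸w) (mapPath F⊆H p) v∉) huv
      where
        v⇝̸w : ¬ v ⇝ w
        v⇝̸w v⇝w = u⇝̸v (u⇝w ◅◅ backwards v⇝w)
        v∉ : v ∉ w ∷ vs
        v∉ v∈ = u⇝̸v (backwards (toStar (proj₂ (dropTo v∈ p))))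

    -- Either an F-path joins u and v, or one joins w to u or v, or u, v, w are pairwise
    -- disconnected and form a triangle in H.
    cycleThrough : Adj H u v → ¬ Adj F u v → w ≢ u → w ≢ v → Cycle (Adj H)
    cycleThrough {u} {v} {w} huv ¬fuv w≢u w≢v with em {u ⇝ v} | em {u ⇝ w} | em {v ⇝ w}
    ... | yes u⇝v | _ | _ with loopErase em u⇝v
    ...   | [] , stop = ⊥-elim (Graph.irrefl H huv)
    ...   | _ ∷ [] , step fuv stop _ = ⊥-elim (¬fuv fuv)
    ...   | _ ∷ _ ∷ _ , p = cycle (mapPath F⊆H p) (Graph.sym H huv)
    cycleThrough huv _ w≢u _ | no u⇝̸v | yes u⇝w | _ = cycleAcrossComponents u⇝̸v u⇝w w≢u huv
    cycleThrough huv _ _ w≢v | no u⇝̸v | no _ | yes v⇝w =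
      cycleAcrossComponents (u⇝̸v ∘ backwards) v⇝w w≢v (Graph.sym H huv)
    cycleThrough {u} {v} {w} huv _ w≢u w≢v | no _ | no u⇝̸w | no v⇝̸w =
      cycle (step huv (step (disconnected⇒H v⇝̸w) stop v∉) u∉) (disconnected⇒H (u⇝̸w ∘ backwards))
      where
        v∉ : v ∉ w ∷ []
        v∉ (here refl) = w≢v refl
        u∉ : u ∉ v ∷ w ∷ []
        u∉ (here refl) = Graph.irrefl H huv
        u∉ (there (here refl)) = w≢u refl

  E-sym : ∀ {I : Set} {pr : I → V × V} {an S} → Symmetric (E (pregraphOf pr an S))
  E-sym (γ , s , t , e) = γ , s , t , swap e

  N-sym : ∀ {I : Set} {pr : I → V × V} {an S} → Symmetric (N (pregraphOf pr an S))
  N-sym (γ , s , f , e) = γ , s , f , swap e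

  module _ (p : Play {V}) where

    private
      _≺_ _≼_ : Rel (I p) 0ℓ
      _≺_ = Play._<_ p
      γ ≼ δ = γ ≺ δ ⊎ γ ≡ δ

      open IsStrictTotalOrder (isSTO p) using (compare) renaming (trans to ≺-trans)

      ≼-≺-trans : ∀ {α β γ} → α ≼ β → β ≺ γ → α ≺ γ
      ≼-≺-trans (inj₁ α≺β) β≺γ = ≺-trans α≺β β≺γ
      ≼-≺-trans (inj₂ refl) β≺γ = β≺γ

    after : I p → Pregraph {V}
    after γ = pregraphOf (pair p) (ans p) (_≼ γ)

    after-mono : ∀ {β γ} → β ≺ γ → E (after β) ⇒ E (after γ)
    after-mono β≺γ (δ , δ≼β , t , e) = δ , inj₁ (≼-≺-trans δ≼β β≺γ) , t , e

    pathBelow : ∀ {S γ₀} → SimplePath (E (pregraphOf (pair p) (ans p) S)) x z vs → S γ₀ →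
                Σ[ γ ∈ I p ] S γ × γ₀ ≼ γ × SimplePath (E (after γ)) x z vs
    pathBelow stop s₀ = _ , s₀ , inj₂ refl , stop
    pathBelow (step (δ , sδ , t , e) path x∉) s₀ with pathBelow path s₀
    ... | γ , sγ , γ₀≼γ , path′ with compare δ γ
    ...   | tri< δ≺γ _ _ = γ , sγ , γ₀≼γ , step (δ , inj₁ δ≺γ , t , e) path′ x∉
    ...   | tri≈ _ refl _ = γ , sγ , γ₀≼γ , step (δ , inj₂ refl , t , e) path′ x∉
    ...   | tri> _ _ γ≺δ =
            δ , sδ , inj₁ (≼-≺-trans γ₀≼γ γ≺δ) ,
            step (δ , inj₂ refl , t , e) (mapPath (after-mono γ≺δ) path′) x∉

    cycleBelow : ∀ {S} → Cycle (E (pregraphOf (pair p) (ans p) S)) →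
                 Σ[ γ ∈ I p ] S γ × Cycle (E (after γ))
    cycleBelow (cycle path (δ , sδ , t , e)) with pathBelow path sδ
    ... | γ , sγ , δ≼γ , path′ = γ , sγ , cycle path′ (δ , δ≼γ , t , e)

    after⊆before∪edge : ∀ {γ} → E (after γ) ⇒ E (before p γ) ∪ SamePair (pair p γ)
    after⊆before∪edge (δ , inj₁ δ≺γ , t , e) = inj₁ (δ , δ≺γ , t , e)
    after⊆before∪edge (_ , inj₂ refl , _ , e) = inj₂ e

    after⊆before : ∀ {γ} → ans p γ ≡ false → E (after γ) ⇒ E (before p γ)
    after⊆before _ (δ , inj₁ δ≺γ , t , e) = δ , δ≺γ , t , e
    after⊆before f (_ , inj₂ refl , t , _) with trans (sym t) f
    ... | ()

    EdgesJoinComponents : Set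
    EdgesJoinComponents =
      ∀ γ → ans p γ ≡ true → ¬ Star (E (before p γ)) (proj₁ (pair p γ)) (proj₂ (pair p γ))

    module _ (joins : EdgesJoinComponents) where

      acyclic-step : ∀ γ → ¬ Cycle (E (before p γ)) → ¬ Cycle (E (after γ))
      acyclic-step γ acyclic cyc with ans p γ in answer
      ... | false = acyclic (mapCycle (after⊆before answer) cyc)
      ... | true with cycle-∪-edge E-sym (mapCycle after⊆before∪edge cyc)
      ...   | inj₁ cyc′ = acyclic cyc′
      ...   | inj₂ joined = joins γ answer joined

      acyclic-after : ∀ γ → Acc _≺_ γ → ¬ Cycle (E (after γ))
      acyclic-after γ (acc rs) = acyclic-step γ λ cyc →
        let δ , δ≺γ , cyc′ = cycleBelow cyc in acyclic-after δ (rs δ≺γ) cyc′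

      acyclic : ¬ Cycle (E (final p))
      acyclic cyc = let γ , _ , cyc′ = cycleBelow cyc in acyclic-after γ (wf p γ) cyc′

  module _ {R : Graph {V} → Set} (p : Play {V}) (legal : Legal R p) where

    private
      open IsStrictTotalOrder (isSTO p) using (compare)

      undetermined : ∀ α → Undetermined (before p α) (proj₁ (pair p α)) (proj₂ (pair p α))
      undetermined α = proj₂ (proj₂ (legal α))

    final-E∩N=∅ : E (final p) x y → ¬ N (final p) x y
    final-E∩N=∅ (γ , _ , t , eγ) (δ , _ , f , eδ) with compare γ δ
    ... | tri< γ<δ _ _ = proj₁ (undetermined δ) (γ , γ<δ , t , samePair-trans eγ (samePair-sym eδ))
    ... | tri> _ _ δ<γ = proj₂ (undetermined γ) (δ , δ<γ , f , samePair-trans eδ (samePair-sym eγ))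
    ... | tri≈ _ refl _ with trans (sym t) f
    ...   | ()

    final-E-irrefl : ¬ E (final p) x x
    final-E-irrefl (γ , _ , _ , inj₁ (e₁ , e₂)) = proj₁ (proj₂ (legal γ)) (trans e₁ (sym e₂))
    final-E-irrefl (γ , _ , _ , inj₂ (e₁ , e₂)) = proj₁ (proj₂ (legal γ)) (trans e₁ (sym e₂))

  pastEdges : Past {V} → Rel V 0ℓ
  pastEdges past x y =
    Σ[ j ∈ Past.J past ] Past.pastAns past j ≡ true × SamePair (Past.pastPair past j) x y

  module _ (em : ExcludedMiddle 0ℓ) where

    joinStrategy : Strategy {V}
    joinStrategy past x y with em {Star (pastEdges past) x y}
    ... | yes _ = false
    ... | no _ = true

    joinStrategy-true : ∀ past → joinStrategy past x y ≡ true → ¬ Star (pastEdges past) x y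
    joinStrategy-true {x} {y} past _ with em {Star (pastEdges past) x y}
    joinStrategy-true past () | yes _
    joinStrategy-true past _ | no ¬s = ¬s

    joinStrategy-false : ∀ past → joinStrategy past x y ≡ false → Star (pastEdges past) x y
    joinStrategy-false {x} {y} past _ with em {Star (pastEdges past) x y}
    joinStrategy-false past _ | yes s = s
    joinStrategy-false past () | no _

    module _ (p : Play {V}) (follows : Follows joinStrategy p) where

      joinStrategy-joins : EdgesJoinComponents p
      joinStrategy-joins γ t =
        joinStrategy-true (pastAt p γ) (trans (sym (follows γ)) t) ∘ mapStar toPast
        where
          toPast : E (before p γ) ⇒ pastEdges (pastAt p γ)
          toPast (δ , δ<γ , t , e) = (δ , δ<γ) , t , e

      nonedge⇒connected : N (final p) x y → Star (E (final p)) x y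
      nonedge⇒connected (δ , _ , f , e) =
        orient E-sym (samePair-sym e)
          (mapStar fromPast (joinStrategy-false (pastAt p δ) (trans (sym (follows δ)) f)))
        where
          fromPast : pastEdges (pastAt p δ) ⇒ E (final p)
          fromPast ((γ , _) , t , e) = γ , _ , t , e

      module _ (legal : Legal HasCycle p) where

        private
          F H : Graph {V}
          F = smallestExtension (final p) E-sym (final-E-irrefl p legal)
          H = largestExtension (final p) N-sym

          F-extends : Extends F (final p)
          F-extends = smallestExtension-extends (final p) (final-E∩N=∅ p legal) E-sym (final-E-irrefl p legal)

          H-extends : Extends H (final p)
          H-extends = largestExtension-extends (final p) (final-E∩N=∅ p legal) (final-E-irrefl p legal) N-sym

          disconnected⇒H : ¬ Star (Adj F) x y → Adj H x y
          disconnected⇒H x⇝̸y = (λ { refl → x⇝̸y ε }) , x⇝̸y ∘ nonedge⇒connected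

        ¬everyExtensionCyclic : ¬ (∀ G → Extends G (final p) → HasCycle G)
        ¬everyExtensionCyclic everyCyclic =
          acyclic p joinStrategy-joins (hasCycle⇒cycle F (everyCyclic F F-extends))

        ¬noExtensionCyclic : x ≢ y → ¬ Determined (final p) x y → w ≢ x → w ≢ y →
                             ¬ (∀ G → Extends G (final p) → ¬ HasCycle G)
        ¬noExtensionCyclic x≢y undetermined w≢x w≢y noneCyclic =
          noneCyclic H H-extends (cycle⇒hasCycle H
            (cycleThrough em F H (proj₁ H-extends) disconnected⇒H
              (x≢y , undetermined ∘ inj₂) (undetermined ∘ inj₁) w≢x w≢y))

    thirdVertex : AtLeast3 V → (u v : V) → Σ[ w ∈ V ] w ≢ u × w ≢ v
    thirdVertex (a , b , c , a≢b , a≢c , b≢c) u v with em {a ≡ u} | em {a ≡ v}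
    ... | no a≢u | no a≢v = a , a≢u , a≢v
    ... | yes refl | _ with em {b ≡ v}
    ...   | yes refl = c , a≢c ∘ sym , b≢c ∘ sym
    ...   | no b≢v = b , a≢b ∘ sym , b≢v
    thirdVertex (a , b , c , a≢b , a≢c , b≢c) u v | no _ | yes refl with em {b ≡ u}
    ...   | yes refl = c , b≢c ∘ sym , a≢c ∘ sym
    ...   | no b≢u = b , b≢u , a≢b ∘ sym

-- Excluded middle is only needed for propositions in Set.
theorem3p1 : ExcludedMiddle 0ℓ → ExcludedMiddle (lsuc 0ℓ) →
    (V : Set) → AtLeast3 V → StronglyElusive {V} HasCycle
theorem3p1 em _ V at3 = joinStrategy em , winning
  where
    winning : Winning HasCycle (joinStrategy em)
    winning p legal follows terminal x y x≢y
      with em {Determined (final p) x y} | terminal | thirdVertex em at3 x y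
    ... | yes determined | _ | _ = determined
    ... | no _ | inj₁ everyCyclic | _ = ⊥-elim (¬everyExtensionCyclic em p follows legal everyCyclic)
    ... | no undetermined | inj₂ noneCyclic | w , w≢x , w≢y =
          ⊥-elim (¬noExtensionCyclic em p follows legal x≢y undetermined w≢x w≢y noneCyclic)
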